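{- Let $z$ be an indeterminate (treated as a scalar) and let $A=\{a,b_0,b_1,b_2,\dots\}$ be an alphabet. For each $k\ge 1$ let $G_k$ be the context-free grammar $$G_k=\{a\to (k-1)(k-1+z)a,\ b_0\to b_1,\ b_1\to b_2,\ \dots,\ b_{k-1}\to b_k\},$$ and let $D_k$ be the formal derivative associated with $G_k$. Then for every $n\ge 1$, $$D_nD_{n-1}\cdots D_1(ab_0)=a\sum_{k=1}^n \mathrm{Jc}_n^k(z)\,b_k.$$
   Context: A context-free grammar $G$ over an alphabet $A$ assigns to each letter of $A$ an element of the ring $\mathbb{Q}[z][[A]]$ of formal power series in the letters of $A$ (with scalars polynomials in $z$). The formal derivative $D=D_G$ is the unique $\mathbb{Q}[z]$-linear derivation (satisfying the Leibniz rule on products) with $D(x)=G(x)$ for each letter $x$; letters without a rule in $G$ (here $b_j$ for $j\ge k$ in $G_k$) are mapped to $0$. The unsigned Jacobi-Stirling numbers of the first kind $\mathrm{Jc}_n^k(z)$ are defined by $\prod_{i=0}^{n-1}(x+i(z+i))=\sum_{k=0}^n\mathrm{Jc}_n^k(z)x^k$; equivalently, $\mathrm{Jc}_n^k(z)=\mathrm{Jc}_{n-1}^{k-1}(z)+(n-1)(n-1+z)\mathrm{Jc}_{n-1}^k(z)$ with $\mathrm{Jc}_n^0(z)=\delta_{n,0}$ and $\mathrm{Jc}_0^k(z)=\delta_{k,0}$. -}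

module Defs where

open import Data.Nat using (ℕ; zero; suc; _<ᵇ_)
open import Data.Nat.Properties using (≤-decTotalOrder)
import Data.Nat as ℕ
open import Data.Integer using (+_)
open import Data.Rational using (ℚ; _/_; 0ℚ; 1ℚ; _+_; _*_)
open import Data.List using (List; []; _∷_; _++_; map; concatMap; foldr; upTo; filter)
import Data.List.Properties as LP
open import Data.List.Sort.InsertionSort.Base ≤-decTotalOrder using (sort)
open import Data.Product using (_×_; _,_; proj₁; proj₂)
open import Data.Bool using (if_then_else_)
open import Relation.Binary.PropositionalEquality using (_≡_)
open import Relation.Nullary.Decidable using (does)

-- The alphabet is {z, a, b₀, b₁, …}; the scalar indeterminate z
-- is encoded as an extra letter on which every derivative vanishes
-- (derivatives are Q[z]-linear, so D z = 0).

Letter : Set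
Letter = ℕ

zL : Letter
zL = 0

aL : Letter
aL = 1

bL : ℕ → Letter
bL j = suc (suc j)

-- A monomial is a word;
-- commutativity is built into the equality (words are compared after
-- sorting), and coefficients of equal monomials are added.

Mon : Set
Mon = List Letter

Poly : Set
Poly = List (ℚ × Mon)

nat : ℕ → ℚ
nat n = + n / 1

mon : Mon → Poly
mon w = (1ℚ , w) ∷ []

scaleQ : ℚ → Poly → Poly
scaleQ c = map (λ t → c * proj₁ t , proj₂ t)

_⊕_ : Poly → Poly → Poly
p ⊕ q = p ++ q

_⊗_ : Poly → Poly → Poly
p ⊗ q = concatMap (λ s → map (λ t → proj₁ s * proj₁ t , proj₂ s ++ proj₂ t) q) p

sumP : List Poly → Poly
sumP = foldr _⊕_ []

coeff : Poly → Mon → ℚ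
coeff p w = foldr (λ t acc → if does (LP.≡-dec Data.Nat._≟_ (sort (proj₂ t)) (sort w))
                               then proj₁ t + acc else acc) 0ℚ p

_≈P_ : Poly → Poly → Set
p ≈P q = ∀ (w : Mon) → coeff p w ≡ coeff q w

-- Given the rule g : Letter → Poly of a grammar, the
-- formal derivative D_g is linear and satisfies Leibniz' rule, so on a
-- monomial x₁ ⋯ x_m it is  Σᵢ x₁ ⋯ x_{i-1} · g(xᵢ) · x_{i+1} ⋯ x_m.

derivWord : (Letter → Poly) → Mon → Poly
derivWord g [] = []
derivWord g (x ∷ w) = (g x ⊗ mon w) ⊕ (mon (x ∷ []) ⊗ derivWord g w)

deriv : (Letter → Poly) → Poly → Poly
deriv g p = concatMap (λ t → scaleQ (proj₁ t) (derivWord g (proj₂ t))) p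

-- (k-1)(k-1+z) a  =  (k-1)² a + (k-1) z a
G : ℕ → Letter → Poly
G k 0 = []
G k 1 = scaleQ (nat ((k ℕ.∸ 1) ℕ.* (k ℕ.∸ 1))) (mon (aL ∷ []))
      ⊕ scaleQ (nat (k ℕ.∸ 1)) (mon (zL ∷ aL ∷ []))
G k (suc (suc j)) = if j <ᵇ k then mon (bL (suc j) ∷ []) else []

D : ℕ → Poly → Poly
D k = deriv (G k)

Ds : ℕ → Poly → Poly
Ds zero p = p
Ds (suc n) p = D (suc n) (Ds n p)

-- the polynomial m(m+z) = m² + m z
iz : ℕ → Poly
iz m = scaleQ (nat (m ℕ.* m)) (mon []) ⊕ scaleQ (nat m) (mon (zL ∷ []))

Jc : ℕ → ℕ → Poly
Jc zero zero = mon []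
Jc zero (suc k) = []
Jc (suc n) zero = []
Jc (suc n) (suc k) = Jc n k ⊕ (iz n ⊗ Jc n (suc k))

rhs : ℕ → Poly
rhs n = mon (aL ∷ []) ⊗ sumP (map (λ i → Jc n (suc i) ⊗ mon (bL (suc i) ∷ [])) (upTo n))

-- Write zᵐabⱼ for the monomial z^m a b_j.  Starting from ab₀, D_k sends a term c·zᵐabⱼ with
-- j < k to c((k-1)² zᵐabⱼ + (k-1) zᵐ⁺¹abⱼ + zᵐabⱼ₊₁); after D_n ⋯ D_1 all b-indices are at most n,
-- so no term is ever killed.  Hence the coefficient table of D_n ⋯ D_1(ab₀) obeys the recurrence
-- Jc_n^j = Jc_{n-1}^{j-1} + (n-1)(n-1+z) Jc_{n-1}^j read coefficientwise in z, and agrees with the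
-- table of Jc.  On the right-hand side, Jc_n^j = 0 for j > n and for j = 0 < n, so the sum over k
-- picks out exactly the term k = j.  Monomials not of the form zᵐabⱼ occur on neither side.
module Submission where

open import Defs
open import Data.Nat as ℕ using (ℕ; zero; suc; _≥_; _<_; _≤_; s≤s; z≤n; _∸_; _≟_)
open import Data.Nat.Properties using (≤-decTotalOrder; m≤n⇒m≤1+n; <⇒<ᵇ)
open import Data.Bool using (Bool; true; false; _∧_)
open import Data.Bool.Properties using (∧-identityʳ; ∧-zeroʳ; T-≡)
open import Data.List using (List; []; _∷_; _++_; map; foldr; upTo; applyUpTo; replicate; length)
open import Data.List.Properties as LP using (map-∘; map-cong; map-upTo; ++-identityʳ)
open import Data.List.Relation.Unary.All as All using (All; []; _∷_)
open import Data.List.Relation.Unary.All.Properties using (++⁺; map⁺)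
open import Data.List.Sort.InsertionSort.Base ≤-decTotalOrder using (sort; insert)
open import Data.Maybe using (Maybe; just; nothing)
open import Data.Maybe.Properties using (just-injective)
open import Data.Product using (_×_; _,_; proj₁; proj₂; map₁; map₂; ∃; uncurry)
open import Data.Product.Properties using (,-injective)
open import Data.Rational using (ℚ; 0ℚ; 1ℚ; _+_; _*_)
open import Data.Rational.Properties as ℚ
  using (+-identityˡ; +-identityʳ; +-assoc; *-identityˡ; *-identityʳ; *-zeroʳ; *-distribˡ-+; *-comm)
open import Data.Rational.Solver using (module +-*-Solver)
open import Data.Sum using (_⊎_; inj₁; inj₂)
open import Function using (_∘_; mk⇔; Equivalence)
open import Relation.Binary.Definitions using (DecidableEquality)
open import Relation.Binary.PropositionalEquality
open import Relation.Nullary using (does)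
open import Relation.Nullary.Decidable using (map′; _×-dec_; does-⇔; dec-false)
open +-*-Solver

select : Bool → ℚ → ℚ
select true  c = c
select false c = 0ℚ

select-* : ∀ b c a → select b (c * a) ≡ a * select b c
select-* true  c a = *-comm c a
select-* false c a = sym (*-zeroʳ a)

coeffWhere : {M : Set} → (M → Bool) → List (ℚ × M) → ℚ
coeffWhere P = foldr (λ t r → select (P (proj₂ t)) (proj₁ t) + r) 0ℚ

module _ {M : Set} where

  coeffWhere-++ : ∀ (P : M → Bool) p q → coeffWhere P (p ++ q) ≡ coeffWhere P p + coeffWhere P q
  coeffWhere-++ P []            q = sym (+-identityˡ _)
  coeffWhere-++ P ((c , u) ∷ p) q =
    trans (cong (select (P u) c +_) (coeffWhere-++ P p q))
          (sym (+-assoc (select (P u) c) (coeffWhere P p) (coeffWhere P q)))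

  coeffWhere-cong-local : ∀ {P Q : M → Bool} {p} →
    All (λ t → P (proj₂ t) ≡ Q (proj₂ t)) p → coeffWhere P p ≡ coeffWhere Q p
  coeffWhere-cong-local []       = refl
  coeffWhere-cong-local (e ∷ es) = cong₂ _+_ (cong (λ b → select b _) e) (coeffWhere-cong-local es)

  coeffWhere-cong : ∀ {P Q : M → Bool} → (∀ u → P u ≡ Q u) → ∀ p → coeffWhere P p ≡ coeffWhere Q p
  coeffWhere-cong e p = coeffWhere-cong-local (All.universal (e ∘ proj₂) p)

  coeffWhere-none : ∀ {P : M → Bool} → (∀ u → P u ≡ false) → ∀ p → coeffWhere P p ≡ 0ℚ
  coeffWhere-none e []            = refl
  coeffWhere-none e ((c , u) ∷ p) rewrite e u = trans (+-identityˡ _) (coeffWhere-none e p)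

  coeffWhere-∧ : ∀ (P : M → Bool) b p → coeffWhere (λ u → P u ∧ b) p ≡ select b (coeffWhere P p)
  coeffWhere-∧ P true  p = coeffWhere-cong (λ u → ∧-identityʳ (P u)) p
  coeffWhere-∧ P false p = coeffWhere-none (λ u → ∧-zeroʳ (P u)) p

  coeffWhere-scale : ∀ {N : Set} (P : N → Bool) a (g : M → N) p →
    coeffWhere P (map (λ t → a * proj₁ t , g (proj₂ t)) p) ≡ a * coeffWhere (P ∘ g) p
  coeffWhere-scale P a g []            = sym (*-zeroʳ a)
  coeffWhere-scale P a g ((c , u) ∷ p) = begin
    select (P (g u)) (a * c) + coeffWhere P (map _ p) ≡⟨ cong₂ _+_ (trans (cong (select (P (g u))) (*-comm a c))
                                                                          (select-* (P (g u)) c a))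
                                                                   (coeffWhere-scale P a g p) ⟩
    a * select (P (g u)) c + a * coeffWhere (P ∘ g) p ≡⟨ sym (*-distribˡ-+ a _ _) ⟩
    a * coeffWhere (P ∘ g) ((c , u) ∷ p)              ∎
    where open ≡-Reasoning

  coeffWhere-map₂ : ∀ {N : Set} (P : N → Bool) (g : M → N) p →
    coeffWhere P (map (map₂ g) p) ≡ coeffWhere (P ∘ g) p
  coeffWhere-map₂ P g []            = refl
  coeffWhere-map₂ P g ((c , u) ∷ p) = cong (select (P (g u)) c +_) (coeffWhere-map₂ P g p)

sumℚ : List ℚ → ℚ
sumℚ = foldr _+_ 0ℚ

coeffWhere-sumP : ∀ (P : Mon → Bool) ps → coeffWhere P (sumP ps) ≡ sumℚ (map (coeffWhere P) ps)
coeffWhere-sumP P []       = refl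
coeffWhere-sumP P (p ∷ ps) = trans (coeffWhere-++ P p _) (cong (coeffWhere P p +_) (coeffWhere-sumP P ps))

coeffWhere-⊗-mon : ∀ (P : Mon → Bool) v p → coeffWhere P (p ⊗ mon v) ≡ coeffWhere (λ u → P (u ++ v)) p
coeffWhere-⊗-mon P v []            = refl
coeffWhere-⊗-mon P v ((c , u) ∷ p) =
  cong₂ _+_ (cong (select (P (u ++ v))) (*-identityʳ c)) (coeffWhere-⊗-mon P v p)

_≟ₘ_ : DecidableEquality Mon
_≟ₘ_ = LP.≡-dec _≟_

coeff-coeffWhere : ∀ p w → coeff p w ≡ coeffWhere (λ u → does (sort u ≟ₘ sort w)) p
coeff-coeffWhere []            w = refl
coeff-coeffWhere ((c , u) ∷ p) w with does (sort u ≟ₘ sort w)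
... | true  = cong (c +_) (coeff-coeffWhere p w)
... | false = trans (coeff-coeffWhere p w) (sym (+-identityˡ _))

zab : ℕ × ℕ → Mon
zab (m , j) = replicate m zL ++ aL ∷ bL j ∷ []

sort-zeros : ∀ l w → sort w ≡ w → sort (replicate l zL ++ w) ≡ replicate l zL ++ w
sort-zeros zero    w e = e
sort-zeros (suc l) w e rewrite sort-zeros l w e = insert-zero (replicate l zL ++ w)
  where
  insert-zero : ∀ v → insert zL v ≡ zL ∷ v
  insert-zero []      = refl
  insert-zero (_ ∷ _) = refl

sort-zab : ∀ x → sort (zab x) ≡ zab x
sort-zab (m , j) = sort-zeros m (aL ∷ bL j ∷ []) refl

sort-a∷zeros∷b : ∀ l j → sort (aL ∷ replicate l zL ++ bL j ∷ []) ≡ zab (l , j)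
sort-a∷zeros∷b l j rewrite sort-zeros l (bL j ∷ []) refl = insert-a l
  where
  insert-a : ∀ l → insert aL (replicate l zL ++ bL j ∷ []) ≡ zab (l , j)
  insert-a zero    = refl
  insert-a (suc l) = cong (zL ∷_) (insert-a l)

decodeZab : Mon → Maybe (ℕ × ℕ)
decodeZab (zero ∷ w) with decodeZab w
... | just (m , j) = just (suc m , j)
... | nothing      = nothing
decodeZab (suc zero ∷ suc (suc j) ∷ []) = just (0 , j)
decodeZab _ = nothing

decodeZab-zab : ∀ x → decodeZab (zab x) ≡ just x
decodeZab-zab (zero  , j) = refl
decodeZab-zab (suc m , j) rewrite decodeZab-zab (m , j) = refl

decodeZab-sound : ∀ w {x} → decodeZab w ≡ just x → zab x ≡ w
decodeZab-sound (zero ∷ w) e with decodeZab w in eq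
decodeZab-sound (zero ∷ w) refl | just (m , j) = cong (zL ∷_) (decodeZab-sound w eq)
decodeZab-sound (suc zero ∷ suc (suc j) ∷ []) refl = refl

zab-injective : ∀ {x y} → zab x ≡ zab y → x ≡ y
zab-injective {x} {y} e =
  just-injective (trans (sym (decodeZab-zab x)) (trans (cong decodeZab e) (decodeZab-zab y)))

zab-or-not : ∀ w → ∃ (λ x → zab x ≡ w) ⊎ (∀ x → zab x ≢ w)
zab-or-not w with decodeZab w in eq
... | just x  = inj₁ (x , decodeZab-sound w eq)
... | nothing = inj₂ λ x e → just≢nothing (trans (sym (decodeZab-zab x)) (trans (cong decodeZab e) eq))
  where
  just≢nothing : ∀ {x : ℕ × ℕ} → just x ≢ nothing
  just≢nothing ()

_≟²_ : DecidableEquality (ℕ × ℕ)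
(m , j) ≟² (m′ , j′) = map′ (uncurry (cong₂ _,_)) ,-injective ((m ≟ m′) ×-dec (j ≟ j′))

does-zab-≟ : ∀ x y → does (zab x ≟ₘ zab y) ≡ does (x ≟² y)
does-zab-≟ x y = does-⇔ (mk⇔ zab-injective (cong zab)) (zab x ≟ₘ zab y) (x ≟² y)

-- G k a = (c₀ k + c₁ k · z) a
c₀ c₁ : ℕ → ℚ
c₀ k = nat ((k ∸ 1) ℕ.* (k ∸ 1))
c₁ k = nat (k ∸ 1)

ZabPoly : Set
ZabPoly = List (ℚ × ℕ × ℕ)

toPoly : ZabPoly → Poly
toPoly = map (map₂ zab)

bIndex : ℚ × ℕ × ℕ → ℕ
bIndex (_ , _ , j) = j

-- The factor 1ℚ makes D k (toPoly L) and toPoly (derivZab k L) equal as lists.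
derivZab : ℕ → ZabPoly → ZabPoly
derivZab k []                = []
derivZab k ((c , m , j) ∷ L) =
  (c * c₀ k , m , j) ∷ (c * c₁ k , suc m , j) ∷ (c * 1ℚ , m , suc j) ∷ derivZab k L

derivWord-zab : ∀ {k j} m → j < k → derivWord (G k) (zab (m , j)) ≡
  (c₀ k , zab (m , j)) ∷ (c₁ k , zab (suc m , j)) ∷ (1ℚ , zab (m , suc j)) ∷ []
derivWord-zab {k} {j} zero j<k
  rewrite Equivalence.to T-≡ (<⇒<ᵇ j<k)
        | *-identityʳ (c₀ k) | *-identityʳ (c₀ k) | *-identityʳ (c₁ k) | *-identityʳ (c₁ k) = refl
derivWord-zab {k} {j} (suc m) j<k
  rewrite derivWord-zab m j<k | *-identityˡ (c₀ k) | *-identityˡ (c₁ k) = refl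

D-toPoly : ∀ k L → All (λ t → bIndex t < k) L → D k (toPoly L) ≡ toPoly (derivZab k L)
D-toPoly k []                []         = refl
D-toPoly k ((c , m , j) ∷ L) (j<k ∷ js) rewrite derivWord-zab m j<k =
  cong (λ r → _ ∷ _ ∷ _ ∷ r) (D-toPoly k L js)

derivZab-bIndex : ∀ k L → All (λ t → bIndex t < k) L → All (λ t → bIndex t < suc k) (derivZab k L)
derivZab-bIndex k []                []         = []
derivZab-bIndex k ((c , m , j) ∷ L) (j<k ∷ js) =
  m≤n⇒m≤1+n j<k ∷ m≤n⇒m≤1+n j<k ∷ s≤s j<k ∷ derivZab-bIndex k L js

zabTerms : ℕ → ZabPoly
zabTerms zero    = (1ℚ , 0 , 0) ∷ []
zabTerms (suc n) = derivZab (suc n) (zabTerms n)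

zabTerms-bIndex : ∀ n → All (λ t → bIndex t < suc n) (zabTerms n)
zabTerms-bIndex zero    = s≤s z≤n ∷ []
zabTerms-bIndex (suc n) = derivZab-bIndex (suc n) (zabTerms n) (zabTerms-bIndex n)

Ds-ab₀ : ∀ n → Ds n (mon (aL ∷ bL 0 ∷ [])) ≡ toPoly (zabTerms n)
Ds-ab₀ zero    = refl
Ds-ab₀ (suc n) rewrite Ds-ab₀ n = D-toPoly (suc n) (zabTerms n) (zabTerms-bIndex n)

shift : (ℕ → ℚ) → ℕ → ℚ
shift f zero    = 0ℚ
shift f (suc m) = f m

shift-cong : ∀ {f g : ℕ → ℚ} → (∀ x → f x ≡ g x) → ∀ m → shift f m ≡ shift g m
shift-cong e zero    = refl
shift-cong e (suc m) = e m

-- On tables f m j indexed by the power m of z and the index j of b: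
-- f ↦ (k-1)(k-1+z) f + (f with j lowered by one).
jsStep : ℕ → (ℕ → ℕ → ℚ) → ℕ → ℕ → ℚ
jsStep k f m j = c₀ k * f m j + (c₁ k * shift (λ x → f x j) m + shift (f m) j)

jsStep-cong : ∀ k {f g : ℕ → ℕ → ℚ} → (∀ m j → f m j ≡ g m j) → ∀ m j → jsStep k f m j ≡ jsStep k g m j
jsStep-cong k e m j = cong₂ (λ x y → c₀ k * x + y) (e m j)
  (cong₂ (λ x y → c₁ k * x + y) (shift-cong (λ x → e x j) m) (shift-cong (e m) j))

coeffWhere-derivZab : ∀ k (Q : ℕ × ℕ → Bool) L → coeffWhere Q (derivZab k L) ≡
  c₀ k * coeffWhere Q L + (c₁ k * coeffWhere (Q ∘ map₁ suc) L + coeffWhere (Q ∘ map₂ suc) L)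
coeffWhere-derivZab k Q []                = solve 2 (λ a b → con 0ℚ := a :* con 0ℚ :+ (b :* con 0ℚ :+ con 0ℚ))
                                              refl (c₀ k) (c₁ k)
coeffWhere-derivZab k Q ((c , m , j) ∷ L) = begin
  select (Q (m , j)) (c * c₀ k) + (select (Q (suc m , j)) (c * c₁ k)
    + (select (Q (m , suc j)) (c * 1ℚ) + coeffWhere Q (derivZab k L)))
    ≡⟨ cong₂ _+_ (select-* (Q (m , j)) c (c₀ k)) (cong₂ _+_ (select-* (Q (suc m , j)) c (c₁ k))
         (cong₂ _+_ (select-* (Q (m , suc j)) c 1ℚ) (coeffWhere-derivZab k Q L))) ⟩
  c₀ k * A + (c₁ k * B + (1ℚ * C + (c₀ k * X + (c₁ k * Y + Z))))
    ≡⟨ solve 8 (λ a b A B C X Y Z → a :* A :+ (b :* B :+ (con 1ℚ :* C :+ (a :* X :+ (b :* Y :+ Z))))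
                 := a :* (A :+ X) :+ (b :* (B :+ Y) :+ (C :+ Z))) refl (c₀ k) (c₁ k) A B C X Y Z ⟩
  c₀ k * (A + X) + (c₁ k * (B + Y) + (C + Z)) ∎
  where
  open ≡-Reasoning
  A = select (Q (m , j)) c
  B = select (Q (suc m , j)) c
  C = select (Q (m , suc j)) c
  X = coeffWhere Q L
  Y = coeffWhere (Q ∘ map₁ suc) L
  Z = coeffWhere (Q ∘ map₂ suc) L

coeffAt : ZabPoly → ℕ → ℕ → ℚ
coeffAt L m j = coeffWhere (λ x → does (x ≟² (m , j))) L

coeffAt-derivZab : ∀ k L m j → coeffAt (derivZab k L) m j ≡ jsStep k (coeffAt L) m j
coeffAt-derivZab k L m j = trans (coeffWhere-derivZab k (λ x → does (x ≟² (m , j))) L)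
  (cong₂ (λ x y → c₀ k * coeffAt L m j + (c₁ k * x + y)) (lower-m m) (lower-j j))
  where
  lower-m : ∀ m → coeffWhere (λ x → does (map₁ suc x ≟² (m , j))) L ≡ shift (λ x → coeffAt L x j) m
  lower-m zero    = coeffWhere-none (λ _ → refl) L
  lower-m (suc m) = refl
  lower-j : ∀ j → coeffWhere (λ x → does (map₂ suc x ≟² (m , j))) L ≡ shift (coeffAt L m) j
  lower-j zero    = coeffWhere-none (λ x → ∧-zeroʳ (does (proj₁ x ≟ m))) L
  lower-j (suc j) = refl

-- the coefficient of zᵐ in Jc_n^j
jc : ℕ → ℕ → ℕ → ℚ
jc n m j = coeffWhere (λ u → does (length u ≟ m)) (Jc n j)

coeffWhere-iz-⊗ : ∀ (P : Mon → Bool) n p →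
  coeffWhere P (iz n ⊗ p) ≡ nat (n ℕ.* n) * coeffWhere P p + nat n * coeffWhere (P ∘ (zL ∷_)) p
coeffWhere-iz-⊗ P n p = begin
  coeffWhere P (M₀ ++ (M₁ ++ []))
    ≡⟨ coeffWhere-++ P M₀ (M₁ ++ []) ⟩
  coeffWhere P M₀ + coeffWhere P (M₁ ++ [])
    ≡⟨ cong (λ q → coeffWhere P M₀ + coeffWhere P q) (++-identityʳ M₁) ⟩
  coeffWhere P M₀ + coeffWhere P M₁
    ≡⟨ cong₂ _+_ (coeffWhere-scale P (nat (n ℕ.* n) * 1ℚ) (λ u → u) p)
                 (coeffWhere-scale P (nat n * 1ℚ) (zL ∷_) p) ⟩
  nat (n ℕ.* n) * 1ℚ * coeffWhere P p + nat n * 1ℚ * coeffWhere (P ∘ (zL ∷_)) p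
    ≡⟨ cong₂ (λ a b → a * coeffWhere P p + b * coeffWhere (P ∘ (zL ∷_)) p)
         (*-identityʳ (nat (n ℕ.* n))) (*-identityʳ (nat n)) ⟩
  nat (n ℕ.* n) * coeffWhere P p + nat n * coeffWhere (P ∘ (zL ∷_)) p ∎
  where
  open ≡-Reasoning
  M₀ = map (λ t → nat (n ℕ.* n) * 1ℚ * proj₁ t , proj₂ t) p
  M₁ = map (λ t → nat n * 1ℚ * proj₁ t , zL ∷ proj₂ t) p

coeffWhere-length-zL∷ : ∀ p m →
  coeffWhere (λ u → does (length (zL ∷ u) ≟ m)) p ≡ shift (λ x → coeffWhere (λ u → does (length u ≟ x)) p) m
coeffWhere-length-zL∷ p zero    = coeffWhere-none (λ _ → refl) p
coeffWhere-length-zL∷ p (suc m) = refl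

shift-zero : ∀ m → shift (λ _ → 0ℚ) m ≡ 0ℚ
shift-zero zero    = refl
shift-zero (suc m) = refl

jc-suc : ∀ n m j → jc (suc n) m j ≡ jsStep (suc n) (jc n) m j
jc-suc zero    m zero    = -- c₀ 1 and c₁ 1 compute to 0ℚ
  solve 2 (λ x y → con 0ℚ := con 0ℚ :* x :+ (con 0ℚ :* y :+ con 0ℚ)) refl (jc 0 m 0) (shift (λ x → jc 0 x 0) m)
jc-suc (suc n) m zero    = begin
  0ℚ
    ≡⟨ solve 2 (λ a b → con 0ℚ := a :* con 0ℚ :+ (b :* con 0ℚ :+ con 0ℚ)) refl (c₀ (2 ℕ.+ n)) (c₁ (2 ℕ.+ n)) ⟩
  c₀ (2 ℕ.+ n) * 0ℚ + (c₁ (2 ℕ.+ n) * 0ℚ + 0ℚ)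
    ≡⟨ cong (λ y → c₀ (2 ℕ.+ n) * 0ℚ + (c₁ (2 ℕ.+ n) * y + 0ℚ)) (sym (shift-zero m)) ⟩
  jsStep (2 ℕ.+ n) (jc (suc n)) m zero ∎
  where open ≡-Reasoning
jc-suc n       m (suc k) = begin
  coeffWhere P (Jc n k ++ iz n ⊗ Jc n (suc k))
    ≡⟨ coeffWhere-++ P (Jc n k) (iz n ⊗ Jc n (suc k)) ⟩
  jc n m k + coeffWhere P (iz n ⊗ Jc n (suc k))
    ≡⟨ cong (jc n m k +_) (coeffWhere-iz-⊗ P n (Jc n (suc k))) ⟩
  jc n m k + (nat (n ℕ.* n) * jc n m (suc k) + nat n * coeffWhere (P ∘ (zL ∷_)) (Jc n (suc k)))
    ≡⟨ cong (λ y → jc n m k + (nat (n ℕ.* n) * jc n m (suc k) + nat n * y))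
         (coeffWhere-length-zL∷ (Jc n (suc k)) m) ⟩
  jc n m k + (nat (n ℕ.* n) * jc n m (suc k) + nat n * shift (λ x → jc n x (suc k)) m)
    ≡⟨ trans (ℚ.+-comm (jc n m k) (A + B)) (+-assoc A B (jc n m k)) ⟩
  jsStep (suc n) (jc n) m (suc k) ∎
  where
  open ≡-Reasoning
  P = λ (u : Mon) → does (length u ≟ m)
  A = nat (n ℕ.* n) * jc n m (suc k)
  B = nat n * shift (λ x → jc n x (suc k)) m

Jc-vanish : ∀ n j → n ≤ j → Jc n (suc j) ≡ []
Jc-vanish zero    j       _       = refl
Jc-vanish (suc n) (suc j) (s≤s p) rewrite Jc-vanish n j p | Jc-vanish n (suc j) (m≤n⇒m≤1+n p) = refl

coeffAt-zabTerms : ∀ n m j → coeffAt (zabTerms n) m j ≡ jc n m j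
coeffAt-zabTerms zero    zero    zero    = refl
coeffAt-zabTerms zero    zero    (suc j) = refl
coeffAt-zabTerms zero    (suc m) zero    = refl
coeffAt-zabTerms zero    (suc m) (suc j) = refl
coeffAt-zabTerms (suc n) m       j       = begin
  coeffAt (derivZab (suc n) (zabTerms n)) m j  ≡⟨ coeffAt-derivZab (suc n) (zabTerms n) m j ⟩
  jsStep (suc n) (coeffAt (zabTerms n)) m j    ≡⟨ jsStep-cong (suc n) (coeffAt-zabTerms n) m j ⟩
  jsStep (suc n) (jc n) m j                    ≡⟨ sym (jc-suc n m j) ⟩
  jc (suc n) m j                               ∎
  where open ≡-Reasoning

IsZPower : Mon → Set
IsZPower u = u ≡ replicate (length u) zL

Jc-zPowers : ∀ n k → All (IsZPower ∘ proj₂) (Jc n k)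
Jc-zPowers zero    zero    = refl ∷ []
Jc-zPowers zero    (suc k) = []
Jc-zPowers (suc n) zero    = []
Jc-zPowers (suc n) (suc k) =
  ++⁺ (Jc-zPowers n k) (++⁺ (map⁺ zPowers) (++⁺ (map⁺ (All.map (cong (zL ∷_)) zPowers)) []))
  where zPowers = Jc-zPowers n (suc k)

sumℚ-zero : ∀ {A : Set} (f : A → ℚ) → (∀ x → f x ≡ 0ℚ) → ∀ xs → sumℚ (map f xs) ≡ 0ℚ
sumℚ-zero f e []       = refl
sumℚ-zero f e (x ∷ xs) = trans (cong₂ _+_ (e x) (sumℚ-zero f e xs)) (+-identityˡ 0ℚ)

sumℚ-select : ∀ k (g : ℕ → ℚ) → (∀ i → k ≤ i → g i ≡ 0ℚ) →
  ∀ j → sumℚ (applyUpTo (λ i → select (does (i ≟ j)) (g i)) k) ≡ g j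
sumℚ-select zero    g vanish j       = sym (vanish j z≤n)
sumℚ-select (suc k) g vanish zero    =
  trans (cong (g 0 +_) (trans (cong sumℚ (sym (map-upTo (λ _ → 0ℚ) k))) (sumℚ-zero _ (λ _ → refl) (upTo k))))
        (+-identityʳ (g 0))
sumℚ-select (suc k) g vanish (suc j) =
  trans (+-identityˡ _) (sumℚ-select k (g ∘ suc) (λ i k≤i → vanish (suc i) (s≤s k≤i)) j)

dsCoeff : ℕ → Mon → ℚ
dsCoeff n s = coeffWhere (λ x → does (zab x ≟ₘ s)) (zabTerms n)

rhsCoeff : ℕ → Mon → ℚ
rhsCoeff n s = sumℚ (map (λ i → coeffWhere (λ u → does (zab (length u , suc i) ≟ₘ s)) (Jc n (suc i))) (upTo n))

coeff-Ds : ∀ n w → coeff (Ds n (mon (aL ∷ bL 0 ∷ []))) w ≡ dsCoeff n (sort w)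
coeff-Ds n w = begin
  coeff (Ds n (mon (aL ∷ bL 0 ∷ []))) w
    ≡⟨ cong (λ p → coeff p w) (Ds-ab₀ n) ⟩
  coeff (toPoly (zabTerms n)) w
    ≡⟨ coeff-coeffWhere (toPoly (zabTerms n)) w ⟩
  coeffWhere P (toPoly (zabTerms n))
    ≡⟨ coeffWhere-map₂ P zab (zabTerms n) ⟩
  coeffWhere (P ∘ zab) (zabTerms n)
    ≡⟨ coeffWhere-cong (λ x → cong (λ v → does (v ≟ₘ sort w)) (sort-zab x)) (zabTerms n) ⟩
  dsCoeff n (sort w) ∎
  where
  open ≡-Reasoning
  P = λ u → does (sort u ≟ₘ sort w)

coeff-rhs : ∀ n w → coeff (rhs n) w ≡ rhsCoeff n (sort w)
coeff-rhs n w = begin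
  coeff (rhs n) w
    ≡⟨ coeff-coeffWhere (rhs n) w ⟩
  coeffWhere P (aS ++ [])
    ≡⟨ cong (coeffWhere P) (++-identityʳ aS) ⟩
  coeffWhere P aS
    ≡⟨ trans (coeffWhere-scale P 1ℚ (aL ∷_) S) (*-identityˡ _) ⟩
  coeffWhere P′ S
    ≡⟨ coeffWhere-sumP P′ (map f (upTo n)) ⟩
  sumℚ (map (coeffWhere P′) (map f (upTo n)))
    ≡⟨ cong sumℚ (sym (map-∘ (upTo n))) ⟩
  sumℚ (map (coeffWhere P′ ∘ f) (upTo n))
    ≡⟨ cong sumℚ (map-cong summand (upTo n)) ⟩
  rhsCoeff n (sort w) ∎
  where
  open ≡-Reasoning
  P  = λ u → does (sort u ≟ₘ sort w)
  P′ = P ∘ (aL ∷_)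
  f  = λ i → Jc n (suc i) ⊗ mon (bL (suc i) ∷ [])
  S  = sumP (map f (upTo n))
  aS = map (λ t → 1ℚ * proj₁ t , aL ∷ proj₂ t) S
  summand : ∀ i → coeffWhere P′ (f i) ≡ coeffWhere (λ u → does (zab (length u , suc i) ≟ₘ sort w)) (Jc n (suc i))
  summand i = trans (coeffWhere-⊗-mon P′ (bL (suc i) ∷ []) (Jc n (suc i)))
    (coeffWhere-cong-local (All.map sorted (Jc-zPowers n (suc i))))
    where
    sorted : ∀ {u} → IsZPower u → P′ (u ++ bL (suc i) ∷ []) ≡ does (zab (length u , suc i) ≟ₘ sort w)
    sorted {u} e = cong (λ v → does (v ≟ₘ sort w))
      (trans (cong (λ v → sort (aL ∷ v ++ bL (suc i) ∷ [])) e) (sort-a∷zeros∷b (length u) (suc i)))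

dsCoeff-zab : ∀ n m j → dsCoeff n (zab (m , j)) ≡ jc n m j
dsCoeff-zab n m j =
  trans (coeffWhere-cong (λ x → does-zab-≟ x (m , j)) (zabTerms n)) (coeffAt-zabTerms n m j)

rhsCoeff-zab : ∀ n m j → rhsCoeff (suc n) (zab (m , j)) ≡ jc (suc n) m j
rhsCoeff-zab n m j = trans (cong sumℚ (map-cong summand (upTo (suc n)))) (select-sum j)
  where
  summand : ∀ i → coeffWhere (λ u → does (zab (length u , suc i) ≟ₘ zab (m , j))) (Jc (suc n) (suc i))
                ≡ select (does (suc i ≟ j)) (jc (suc n) m (suc i))
  summand i = trans (coeffWhere-cong (λ u → does-zab-≟ (length u , suc i) (m , j)) (Jc (suc n) (suc i)))
                    (coeffWhere-∧ (λ u → does (length u ≟ m)) (does (suc i ≟ j)) (Jc (suc n) (suc i)))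
  select-sum : ∀ j → sumℚ (map (λ i → select (does (suc i ≟ j)) (jc (suc n) m (suc i))) (upTo (suc n)))
                     ≡ jc (suc n) m j
  select-sum zero    = sumℚ-zero _ (λ _ → refl) (upTo (suc n))
  select-sum (suc j) = trans (cong sumℚ (map-upTo (λ i → select (does (suc i ≟ suc j)) (jc (suc n) m (suc i))) (suc n)))
    (sumℚ-select (suc n) (λ i → jc (suc n) m (suc i))
      (λ i n<i → cong (coeffWhere (λ u → does (length u ≟ m))) (Jc-vanish (suc n) i n<i)) j)

dsCoeff-away : ∀ n s → (∀ x → zab x ≢ s) → dsCoeff n s ≡ 0ℚ
dsCoeff-away n s away = coeffWhere-none (λ x → dec-false (zab x ≟ₘ s) (away x)) (zabTerms n)

rhsCoeff-away : ∀ n s → (∀ x → zab x ≢ s) → rhsCoeff n s ≡ 0ℚ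
rhsCoeff-away n s away = sumℚ-zero _
  (λ i → coeffWhere-none (λ u → dec-false (zab (length u , suc i) ≟ₘ s) (away _)) (Jc n (suc i))) (upTo n)

theorem3 : (n : ℕ) → n ≥ 1 → Ds n (mon (aL ∷ bL 0 ∷ [])) ≈P rhs n
theorem3 (suc n) _ w = begin
  coeff (Ds (suc n) (mon (aL ∷ bL 0 ∷ []))) w ≡⟨ coeff-Ds (suc n) w ⟩
  dsCoeff (suc n) (sort w)                    ≡⟨ agree (sort w) (zab-or-not (sort w)) ⟩
  rhsCoeff (suc n) (sort w)                   ≡⟨ sym (coeff-rhs (suc n) w) ⟩
  coeff (rhs (suc n)) w                       ∎
  where
  open ≡-Reasoning
  agree : ∀ s → ∃ (λ x → zab x ≡ s) ⊎ (∀ x → zab x ≢ s) → dsCoeff (suc n) s ≡ rhsCoeff (suc n) s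
  agree _ (inj₁ ((m , j) , refl)) = trans (dsCoeff-zab (suc n) m j) (sym (rhsCoeff-zab n m j))
  agree s (inj₂ away)             = trans (dsCoeff-away (suc n) s away) (sym (rhsCoeff-away (suc n) s away))
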